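{- There are infinitely many pairwise d.p.-inequivalent graph polynomials of the form $\mathbf{P}^{span}_{\mathcal{D}}(G;X)$, where $\mathcal{D}$ ranges over graph properties closed under adding isolated vertices.
   Context: All graphs are finite without multiple edges. A graph property is an isomorphism-closed class of graphs. For a graph property $\mathcal{D}$ closed under adding isolated vertices, $\mathbf{P}^{span}_{\mathcal{D}}(G;X)=\sum_{B\subseteq E(G):(V(G),B)\in\mathcal{D}}X^{|B|}$. Two graph polynomials $\mathbf{P},\mathbf{Q}$ are d.p.-equivalent if for all graphs $G,H$: $\mathbf{P}(G)=\mathbf{P}(H)$ iff $\mathbf{Q}(G)=\mathbf{Q}(H)$. -}

module Defs where

open import Data.Bool using (Bool; true; false; _∧_; _∨_; not; if_then_else_)
open import Data.Bool.Properties using (∨-comm; ∧-zeroʳ)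
open import Data.Nat using (ℕ; zero; suc; _<?_; _≡ᵇ_)
open import Data.Fin using (Fin; zero; suc; toℕ; _≟_)
open import Data.Bool.ListAction using (any)
open import Data.List using (List; []; _∷_; length; filterᵇ; allFin; concatMap; map; _++_)
open import Data.Product using (_×_; _,_; Σ; proj₁; proj₂)
open import Function.Bundles using (_↔_; Inverse)
open import Relation.Nullary using (does; yes; no)
open import Relation.Nullary.Decidable using (⌊_⌋)
open import Relation.Binary.PropositionalEquality using (_≡_; refl; sym; cong)
open import Function.Bundles using (_⇔_)
open import Relation.Nullary using (¬_)

record Graph : Set where
  field
    n      : ℕ
    adj    : Fin n → Fin n → Bool
    adjSym : ∀ i j → adj i j ≡ adj j i
    adjIrr : ∀ i → adj i i ≡ false
open Graph public

_≅_ : Graph → Graph → Set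
G ≅ H = Σ (Fin (n G) ↔ Fin (n H)) λ σ →
  ∀ i j → adj G i j ≡ adj H (Inverse.to σ i) (Inverse.to σ j)

addIsolated : Graph → Graph
addIsolated G = record { n = suc (n G) ; adj = a ; adjSym = s ; adjIrr = r }
  where
  a : Fin (suc (n G)) → Fin (suc (n G)) → Bool
  a zero _ = false
  a (suc i) zero = false
  a (suc i) (suc j) = adj G i j
  s : ∀ i j → a i j ≡ a j i
  s zero zero = refl
  s zero (suc j) = refl
  s (suc i) zero = refl
  s (suc i) (suc j) = adjSym G i j
  r : ∀ i → a i i ≡ false
  r zero = refl
  r (suc i) = adjIrr G i

record GraphProperty : Set where
  field
    holds   : Graph → Bool
    isoInv  : ∀ G H → G ≅ H → holds G ≡ holds H
open GraphProperty public

ClosedUnderIsolated : GraphProperty → Set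
ClosedUnderIsolated D = ∀ G → holds D G ≡ true → holds D (addIsolated G) ≡ true

pairs : (m : ℕ) → List (Fin m × Fin m)
pairs m = concatMap (λ i → map (λ j → (i , j))
            (filterᵇ (λ j → ⌊ toℕ i <? toℕ j ⌋) (allFin m))) (allFin m)

edges : (G : Graph) → List (Fin (n G) × Fin (n G))
edges G = filterᵇ (λ p → adj G (proj₁ p) (proj₂ p)) (pairs (n G))

-- All sublists (= all subsets of a duplicate-free list).
sublists : ∀ {A : Set} → List A → List (List A)
sublists [] = [] ∷ []
sublists (x ∷ xs) = sublists xs ++ map (x ∷_) (sublists xs)

private
  neq : ∀ {m} → Fin m → Fin m → Bool
  neq i j = not ⌊ i ≟ j ⌋

  neq-sym : ∀ {m} (i j : Fin m) → neq i j ≡ neq j i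
  neq-sym i j with i ≟ j | j ≟ i
  ... | yes _ | yes _ = refl
  ... | no _  | no _  = refl
  ... | yes p | no q  = Data.Empty.⊥-elim (q (sym p))
    where import Data.Empty
  ... | no p  | yes q = Data.Empty.⊥-elim (p (sym q))
    where import Data.Empty

  neq-diag : ∀ {m} (i : Fin m) → neq i i ≡ false
  neq-diag i with i ≟ i
  ... | yes _ = refl
  ... | no p  = Data.Empty.⊥-elim (p refl)
    where import Data.Empty

memB : ∀ {m} → Fin m × Fin m → List (Fin m × Fin m) → Bool
memB (i , j) = any (λ p → ⌊ i ≟ proj₁ p ⌋ ∧ ⌊ j ≟ proj₂ p ⌋)

spanning : (m : ℕ) → List (Fin m × Fin m) → Graph
spanning m B = record { n = m ; adj = a ; adjSym = s ; adjIrr = r }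
  where
  a : Fin m → Fin m → Bool
  a i j = neq i j ∧ (memB (i , j) B ∨ memB (j , i) B)
  s : ∀ i j → a i j ≡ a j i
  s i j rewrite neq-sym i j | ∨-comm (memB (i , j) B) (memB (j , i) B) = refl
  r : ∀ i → a i i ≡ false
  r i rewrite neq-diag i = refl

-- P^span_D(G;X) = Σ_{B ⊆ E(G), (V(G),B) ∈ D} X^{|B|}, represented by its
-- coefficient sequence: coefficient of X^k.
Pspan : GraphProperty → Graph → ℕ → ℕ
Pspan D G k = length (filterᵇ (λ B → holds D (spanning (n G) B) ∧ (length B ≡ᵇ k))
                              (sublists (edges G)))

_≈P_ : (ℕ → ℕ) → (ℕ → ℕ) → Set
p ≈P q = ∀ k → p k ≡ q k

DPEquiv : (Graph → ℕ → ℕ) → (Graph → ℕ → ℕ) → Set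
DPEquiv P Q = ∀ G H → (P G ≈P P H) ⇔ (Q G ≈P Q H)

-- The family used is  D i = "the graph has at least i vertices".  Having at
-- least i vertices is invariant under isomorphism (isomorphic graphs have the
-- same order, as a bijection Fin m ↔ Fin n forces m ≡ n) and is preserved by
-- adding an isolated vertex.
--
-- The witnesses are the edgeless graphs E m on m vertices.  For any property D,
-- the only edge set of E m is the empty one, so Pspan D (E m) is the constant
-- polynomial 1 if D holds of E m and 0 otherwise.  Hence for i < j:
--   * Pspan (D i) (E i) = Pspan (D i) (E j) = 1, since both graphs have ≥ i
--     vertices;
--   * Pspan (D j) (E i) = 0 ≠ 1 = Pspan (D j) (E j),
-- so the pair (E i , E j) separates the two polynomials.  Distinct indices are
-- handled by trichotomy, using that d.p.-equivalence is symmetric.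
module Submission where

open import Defs
open import Data.Nat using (ℕ; suc; _≤?_; _≡ᵇ_; _≤_; _<_)
open import Data.Nat.Properties using (≤-refl; <⇒≤; <⇒≱; m≤n⇒m≤1+n; 0≢1+n; <-cmp)
open import Data.Fin.Properties using (cantor-schröder-bernstein)
open import Data.Bool using (true; false; _∧_; if_then_else_)
open import Data.List using (List; []; _∷_; filterᵇ)
open import Data.Product using (Σ; _×_; _,_)
open import Function.Bundles using (Injection; Equivalence)
open import Function.Properties.Inverse using (↔-sym; ↔⇒↣)
import Function.Properties.Equivalence as Equivalence
open import Relation.Binary using (tri<; tri≈; tri>)
open import Relation.Binary.PropositionalEquality using (_≡_; _≢_; refl; sym; trans; cong; module ≡-Reasoning)
open import Relation.Nullary using (¬_; yes; no; contradiction)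
open import Relation.Nullary.Decidable using (⌊_⌋)

≅⇒sameOrder : ∀ G H → G ≅ H → n G ≡ n H
≅⇒sameOrder G H (σ , _) =
  cantor-schröder-bernstein (Injection.injective (↔⇒↣ σ))
                            (Injection.injective (↔⇒↣ (↔-sym σ)))

atLeast : ℕ → GraphProperty
atLeast i = record
  { holds  = λ G → ⌊ i ≤? n G ⌋
  ; isoInv = λ G H G≅H → cong (λ m → ⌊ i ≤? m ⌋) (≅⇒sameOrder G H G≅H)
  }

atLeast-closed : (i : ℕ) → ClosedUnderIsolated (atLeast i)
atLeast-closed i G holdsG with i ≤? n G | i ≤? suc (n G)
... | yes _   | yes _    = refl
... | yes i≤n | no  i≰sn = contradiction (m≤n⇒m≤1+n i≤n) i≰sn
... | no  _   | _        with holdsG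
...                         | ()

edgeless : ℕ → Graph
edgeless m = record
  { n = m ; adj = λ _ _ → false ; adjSym = λ _ _ → refl ; adjIrr = λ _ → refl }

filterᵇ-false : ∀ {A : Set} (xs : List A) → filterᵇ (λ _ → false) xs ≡ []
filterᵇ-false []       = refl
filterᵇ-false (_ ∷ xs) = filterᵇ-false xs

Pspan-edgeless : ∀ D m k →
  Pspan D (edgeless m) k ≡ (if holds D (spanning m []) ∧ (0 ≡ᵇ k) then 1 else 0)
Pspan-edgeless D m k rewrite filterᵇ-false (pairs m)
  with holds D (spanning m []) ∧ (0 ≡ᵇ k)
... | true  = refl
... | false = refl

one : ℕ → ℕ
one k = if 0 ≡ᵇ k then 1 else 0

Pspan-atLeast-large : ∀ i m → i ≤ m → Pspan (atLeast i) (edgeless m) ≈P one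
Pspan-atLeast-large i m i≤m k rewrite Pspan-edgeless (atLeast i) m k with i ≤? m
... | yes _   = refl
... | no  i≰m = contradiction i≤m i≰m

Pspan-atLeast-small : ∀ i m → m < i → Pspan (atLeast i) (edgeless m) 0 ≡ 0
Pspan-atLeast-small i m m<i rewrite Pspan-edgeless (atLeast i) m 0 with i ≤? m
... | yes i≤m = contradiction i≤m (<⇒≱ m<i)
... | no  _   = refl

DPEquiv-sym : ∀ P Q → DPEquiv P Q → DPEquiv Q P
DPEquiv-sym P Q P~Q G H = Equivalence.sym (P~Q G H)

atLeast-separated : ∀ i j → i < j →
  ¬ DPEquiv (Pspan (atLeast i)) (Pspan (atLeast j))
atLeast-separated i j i<j equiv = 0≢1+n zero≡one
  where
  sameForI : Pspan (atLeast i) (edgeless i) ≈P Pspan (atLeast i) (edgeless j)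
  sameForI k = trans (Pspan-atLeast-large i i ≤-refl k)
                     (sym (Pspan-atLeast-large i j (<⇒≤ i<j) k))

  zero≡one : 0 ≡ 1
  zero≡one = begin
    0                                    ≡⟨ sym (Pspan-atLeast-small j i i<j) ⟩
    Pspan (atLeast j) (edgeless i) 0     ≡⟨ Equivalence.to (equiv (edgeless i) (edgeless j)) sameForI 0 ⟩
    Pspan (atLeast j) (edgeless j) 0     ≡⟨ Pspan-atLeast-large j j ≤-refl 0 ⟩
    1                                    ∎
    where open ≡-Reasoning

theorem13 : Σ (ℕ → GraphProperty) λ D →
              ((i : ℕ) → ClosedUnderIsolated (D i))
              × (∀ i j → i ≢ j → ¬ DPEquiv (Pspan (D i)) (Pspan (D j)))
theorem13 = atLeast , atLeast-closed , pairwiseInequivalent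
  where
  pairwiseInequivalent : ∀ i j → i ≢ j →
    ¬ DPEquiv (Pspan (atLeast i)) (Pspan (atLeast j))
  pairwiseInequivalent i j i≢j with <-cmp i j
  ... | tri< i<j _ _ = atLeast-separated i j i<j
  ... | tri≈ _ i≡j _ = contradiction i≡j i≢j
  ... | tri> _ _ j<i = λ equiv →
    atLeast-separated j i j<i (DPEquiv-sym _ _ equiv)
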